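{- Let $G$ be a connected graph with $\gamma_I^p(G)>2$. Then $\gamma_I^p(G)=3$ if and only if the complement $\overline{G}$ has a perfect dominating set of size $3$.
   Context: All graphs are finite, simple and undirected; $\overline{G}$ denotes the complement of $G$. For a graph $G=(V,E)$ and $v\in V$, $N(v)$ denotes the set of neighbours of $v$. A perfect Italian dominating function (PID-function) of $G$ is a function $f:V\to\{0,1,2\}$ such that for every vertex $v$ with $f(v)=0$ one has $\sum_{u\in N(v)} f(u)=2$. The weight of $f$ is $\sum_{v\in V} f(v)$; $\gamma_I^p(G)$ is the minimum weight of a PID-function of $G$. A perfect dominating set of a graph $H$ is a dominating set $D$ of $H$ such that every vertex of $H$ not in $D$ has exactly one neighbour in $D$. -}

module Defs where

open import Data.Nat using (ℕ; zero; suc; _+_; _≤_; _<_)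
open import Data.Fin using (Fin; zero; suc; toℕ; _≟_)
open import Data.Fin.Subset using (Subset; _∈_; _∉_; ∣_∣)
open import Data.Bool using (Bool; true; false; not; _∧_; if_then_else_)
open import Data.Bool.Properties using (∧-zeroʳ)
open import Data.Vec using (lookup)
open import Data.Empty using (⊥-elim)
open import Data.Product using (Σ; _×_; _,_; ∃; ∃-syntax)
open import Relation.Nullary using (¬_; yes; no)
open import Relation.Nullary.Decidable using (⌊_⌋)
open import Relation.Binary.PropositionalEquality as Eq using (_≡_; refl; cong₂)

record Graph (n : ℕ) : Set where
  field
    adj    : Fin n → Fin n → Bool
    adj-sym : ∀ u v → adj u v ≡ adj v u
    adj-irrefl : ∀ v → adj v v ≡ false
open Graph public

sumFin : ∀ {n} → (Fin n → ℕ) → ℕ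
sumFin {zero}  f = 0
sumFin {suc n} f = f zero + sumFin (λ i → f (suc i))

complement : ∀ {n} → Graph n → Graph n
complement {n} G = record
  { adj = cadj
  ; adj-sym = symC
  ; adj-irrefl = irrC
  }
  where
  cadj : Fin n → Fin n → Bool
  cadj u v = not (adj G u v) ∧ not ⌊ u ≟ v ⌋
  symC : ∀ u v → cadj u v ≡ cadj v u
  symC u v with u ≟ v | v ≟ u
  ... | yes p | yes q = Eq.trans (∧-zeroʳ _) (Eq.sym (∧-zeroʳ _))
  ... | yes refl | no q = ⊥-elim (q refl)
  ... | no p | yes refl = ⊥-elim (p refl)
  ... | no p | no q = cong₂ _∧_ (Eq.cong not (adj-sym G u v)) refl
  irrC : ∀ v → cadj v v ≡ false
  irrC v with v ≟ v
  ... | yes _ = ∧-zeroʳ _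
  ... | no ¬p = ⊥-elim (¬p refl)

data Reachable {n} (G : Graph n) : Fin n → Fin n → Set where
  here : ∀ {v} → Reachable G v v
  step : ∀ {u v w} → adj G u v ≡ true → Reachable G v w → Reachable G u w

Connected : ∀ {n} → Graph n → Set
Connected G = ∀ u v → Reachable G u v

weight : ∀ {n} → (Fin n → Fin 3) → ℕ
weight f = sumFin (λ v → toℕ (f v))

nbrSum : ∀ {n} → Graph n → (Fin n → Fin 3) → Fin n → ℕ
nbrSum G f v = sumFin (λ u → if adj G v u then toℕ (f u) else 0)

IsPIDF : ∀ {n} → Graph n → (Fin n → Fin 3) → Set
IsPIDF G f = ∀ v → f v ≡ zero → nbrSum G f v ≡ 2

PIDNumber : ∀ {n} → Graph n → ℕ → Set
PIDNumber G k =
  (Σ _ λ f → IsPIDF G f × weight f ≡ k) ×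
  (∀ f → IsPIDF G f → k ≤ weight f)

PIDNumberGreaterThan2 : ∀ {n} → Graph n → Set
PIDNumberGreaterThan2 G = ∀ f → IsPIDF G f → 2 < weight f

nbrsIn : ∀ {n} → Graph n → Subset n → Fin n → ℕ
nbrsIn G D v = sumFin (λ u → if adj G v u ∧ lookup D u then 1 else 0)

Dominating : ∀ {n} → Graph n → Subset n → Set
Dominating G D = ∀ v → v ∉ D → Σ (Fin _) λ u → u ∈ D × adj G v u ≡ true

PerfectDominating : ∀ {n} → Graph n → Subset n → Set
PerfectDominating G D = Dominating G D × (∀ v → v ∉ D → nbrsIn G D v ≡ 1)

-- For v outside a set D, the neighbours of v in D in G and in the complement of G
-- partition D.  So for the indicator function f of a 3-set D, f is a PID-function
-- of G (each v ∉ D sees exactly 2 of D in G) iff D is a perfect dominating set of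
-- the complement (each v ∉ D sees exactly 1 of D there).  It remains to see that a
-- PID-function of weight 3 never takes the value 2: if f a = 2 and f b = 1, then
-- every other vertex is adjacent to a and not to b; so either a is universal, and
-- the function 2 at a alone has weight 2, or b is isolated, contradicting
-- connectedness.
module Submission where

open import Defs
open import Data.Bool using (Bool; true; false; not; _∧_; if_then_else_)
open import Data.Empty using (⊥-elim)
open import Data.Fin using (Fin; zero; suc; toℕ; _≟_)
open import Data.Fin.Patterns using (0F; 1F; 2F)
open import Data.Fin.Properties using (toℕ-injective)
open import Data.Fin.Subset using (Subset; ∣_∣; _∈_; _∉_)
open import Data.Nat using (ℕ; zero; suc; pred; _+_; _<_)
open import Data.Nat.Properties
  using (+-identityʳ; +-cancelˡ-≡; +-cancelʳ-≡; m+n≡0⇒m≡0; m+n≡0⇒n≡0; n≮n;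
         +-0-commutativeMonoid; +-commutativeSemigroup)
open import Algebra.Properties.CommutativeMonoid.Sum +-0-commutativeMonoid
  using (sum; sum-cong-≗; ∑-distrib-+; sum-replicate-zero)
open import Algebra.Properties.CommutativeSemigroup +-commutativeSemigroup
  using (x∙yz≈y∙xz)
open import Data.Product using (Σ; _×_; _,_; proj₁; proj₂; ∃-syntax)
open import Data.Vec using ([]; _∷_; lookup; tabulate)
open import Data.Vec.Properties using (lookup∘tabulate; lookup⇒[]=; []=⇒lookup)
open import Function using (_∘_)
open import Function.Bundles using (_⇔_; mk⇔)
open import Relation.Nullary using (¬_; yes; no; does)
open import Relation.Binary.PropositionalEquality
  using (_≡_; _≢_; _≗_; refl; sym; trans; cong; cong₂; subst; module ≡-Reasoning)
open ≡-Reasoning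

private
  variable
    n : ℕ

sumFin≡sum : (h : Fin n → ℕ) → sumFin h ≡ sum h
sumFin≡sum {zero}  h = refl
sumFin≡sum {suc n} h = cong (h zero +_) (sumFin≡sum (h ∘ suc))

sumFin-cong : {g h : Fin n → ℕ} → g ≗ h → sumFin g ≡ sumFin h
sumFin-cong {g = g} {h} g≗h = begin
  sumFin g  ≡⟨ sumFin≡sum g ⟩
  sum g     ≡⟨ sum-cong-≗ g≗h ⟩
  sum h     ≡⟨ sumFin≡sum h ⟨
  sumFin h  ∎

sumFin-distrib-+ : (g h : Fin n → ℕ) → sumFin (λ x → g x + h x) ≡ sumFin g + sumFin h
sumFin-distrib-+ g h = begin
  sumFin (λ x → g x + h x)  ≡⟨ sumFin≡sum (λ x → g x + h x) ⟩
  sum (λ x → g x + h x)     ≡⟨ ∑-distrib-+ g h ⟩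
  sum g + sum h             ≡⟨ cong₂ _+_ (sumFin≡sum g) (sumFin≡sum h) ⟨
  sumFin g + sumFin h       ∎

sumFin-zero : {h : Fin n → ℕ} → (∀ x → h x ≡ 0) → sumFin h ≡ 0
sumFin-zero {n} {h} h≗0 = trans (sumFin≡sum h) (trans (sum-cong-≗ h≗0) (sum-replicate-zero n))

sumFin≡0⇒≡0 : (h : Fin n → ℕ) → sumFin h ≡ 0 → ∀ x → h x ≡ 0
sumFin≡0⇒≡0 h eq zero    = m+n≡0⇒m≡0 (h zero) eq
sumFin≡0⇒≡0 h eq (suc x) = sumFin≡0⇒≡0 (h ∘ suc) (m+n≡0⇒n≡0 (h zero) eq) x

sumFin≡1⇒singleton : (h : Fin n → ℕ) → sumFin h ≡ 1 →
  ∃[ b ] h b ≡ 1 × (∀ x → x ≢ b → h x ≡ 0)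
sumFin≡1⇒singleton {suc n} h eq with h zero in h₀
... | 0 with sumFin≡1⇒singleton (h ∘ suc) eq
...   | b , hb≡1 , rest = suc b , hb≡1 , λ where
          zero    _     → h₀
          (suc x) x≢b   → rest x (x≢b ∘ cong suc)
sumFin≡1⇒singleton {suc n} h eq | 1 = zero , h₀ , λ where
  zero    0≢0 → ⊥-elim (0≢0 refl)
  (suc x) _   → sumFin≡0⇒≡0 (h ∘ suc) (cong pred eq) x
sumFin≡1⇒singleton {suc n} h () | suc (suc _)

_except_ : (Fin n → ℕ) → Fin n → Fin n → ℕ
(h except a) x = if does (x ≟ a) then 0 else h x

except-self : (h : Fin n → ℕ) (a : Fin n) → (h except a) a ≡ 0
except-self h a with a ≟ a
... | yes _   = refl
... | no a≢a = ⊥-elim (a≢a refl)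

except-other : (h : Fin n → ℕ) {a x : Fin n} → x ≢ a → (h except a) x ≡ h x
except-other h {a} {x} x≢a with x ≟ a
... | yes x≡a = ⊥-elim (x≢a x≡a)
... | no _    = refl

sumFin-except : (h : Fin n → ℕ) (a : Fin n) → sumFin h ≡ h a + sumFin (h except a)
sumFin-except h zero    = refl
sumFin-except h (suc a) = begin
  h zero + sumFin (h ∘ suc)                               ≡⟨ cong (h zero +_) (sumFin-except (h ∘ suc) a) ⟩
  h zero + (h (suc a) + sumFin ((h ∘ suc) except a))      ≡⟨ x∙yz≈y∙xz (h zero) (h (suc a)) _ ⟩
  h (suc a) + (h zero + sumFin ((h ∘ suc) except a))      ≡⟨⟩
  h (suc a) + sumFin (h except suc a)                     ∎

sumFin-point : (h : Fin n → ℕ) (a : Fin n) → (∀ x → x ≢ a → h x ≡ 0) → sumFin h ≡ h a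
sumFin-point h a vanish = begin
  sumFin h                     ≡⟨ sumFin-except h a ⟩
  h a + sumFin (h except a)    ≡⟨ cong (h a +_) (sumFin-zero except-vanishes) ⟩
  h a + 0                      ≡⟨ +-identityʳ (h a) ⟩
  h a                          ∎
  where
  except-vanishes : ∀ x → (h except a) x ≡ 0
  except-vanishes x with x ≟ a
  ... | yes _   = refl
  ... | no x≢a = vanish x x≢a

sumFin-pair : (h : Fin n → ℕ) {a b : Fin n} → b ≢ a → (∀ x → x ≢ a → x ≢ b → h x ≡ 0) →
  sumFin h ≡ h a + h b
sumFin-pair h {a} {b} b≢a vanish = begin
  sumFin h                     ≡⟨ sumFin-except h a ⟩
  h a + sumFin (h except a)    ≡⟨ cong (h a +_) (sumFin-point (h except a) b except-vanishes) ⟩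
  h a + (h except a) b         ≡⟨ cong (h a +_) (except-other h b≢a) ⟩
  h a + h b                    ∎
  where
  except-vanishes : ∀ x → x ≢ b → (h except a) x ≡ 0
  except-vanishes x x≢b with x ≟ a
  ... | yes _   = refl
  ... | no x≢a = vanish x x≢a x≢b

sumFin≡+1⇒pair : (h : Fin n → ℕ) (a : Fin n) → sumFin h ≡ h a + 1 →
  ∃[ b ] b ≢ a × h b ≡ 1 × (∀ x → x ≢ a → x ≢ b → h x ≡ 0)
sumFin≡+1⇒pair h a eq
  with sumFin≡1⇒singleton (h except a) (+-cancelˡ-≡ (h a) _ _ (trans (sym (sumFin-except h a)) eq))
... | b , hb≡1 , rest = b , b≢a , trans (sym (except-other h b≢a)) hb≡1 , vanish
  where
  b≢a : b ≢ a
  b≢a refl with () ← trans (sym (except-self h a)) hb≡1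
  vanish : ∀ x → x ≢ a → x ≢ b → h x ≡ 0
  vanish x x≢a x≢b = trans (sym (except-other h x≢a)) (rest x x≢b)

nbrWeight : Graph n → (Fin n → ℕ) → Fin n → ℕ
nbrWeight G h v = sumFin (λ u → if adj G v u then h u else 0)

nbrWeight-cong : (G : Graph n) {g h : Fin n → ℕ} → g ≗ h → ∀ v → nbrWeight G g v ≡ nbrWeight G h v
nbrWeight-cong G g≗h v = sumFin-cong (λ u → cong (λ k → if adj G v u then k else 0) (g≗h u))

nbrWeight+nbrWeight-complement : (G : Graph n) (h : Fin n → ℕ) (v : Fin n) → h v ≡ 0 →
  nbrWeight G h v + nbrWeight (complement G) h v ≡ sumFin h
nbrWeight+nbrWeight-complement G h v hv≡0 =
  trans (sym (sumFin-distrib-+ (inGraph G) (inGraph (complement G)))) (sumFin-cong split)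
  where
  inGraph : Graph _ → Fin _ → ℕ
  inGraph H u = if adj H v u then h u else 0
  split : ∀ u → (if adj G v u then h u else 0) + (if adj (complement G) v u then h u else 0) ≡ h u
  split u with v ≟ u
  ... | yes refl rewrite adj-irrefl G v = sym hv≡0
  ... | no _ with adj G v u
  ...   | true  = +-identityʳ (h u)
  ...   | false = refl

indicator : Subset n → Fin n → Fin 3
indicator D u = if lookup D u then 1F else 0F

∣∣≡weight-indicator : (D : Subset n) → ∣ D ∣ ≡ weight (indicator D)
∣∣≡weight-indicator []          = refl
∣∣≡weight-indicator (true ∷ D)  = cong suc (∣∣≡weight-indicator D)
∣∣≡weight-indicator (false ∷ D) = ∣∣≡weight-indicator D

∉⇒indicator≡0 : (D : Subset n) {v : Fin n} → v ∉ D → indicator D v ≡ 0F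
∉⇒indicator≡0 D {v} v∉D with lookup D v in v∈?D
... | true  = ⊥-elim (v∉D (lookup⇒[]= v D v∈?D))
... | false = refl

indicator≡0⇒∉ : (D : Subset n) {v : Fin n} → indicator D v ≡ 0F → v ∉ D
indicator≡0⇒∉ D {v} eq v∈D rewrite []=⇒lookup v∈D with () ← eq

nbrsIn≡nbrWeight : (G : Graph n) (D : Subset n) (v : Fin n) →
  nbrsIn G D v ≡ nbrWeight G (toℕ ∘ indicator D) v
nbrsIn≡nbrWeight G D v = sumFin-cong term
  where
  term : ∀ u → (if adj G v u ∧ lookup D u then 1 else 0) ≡ (if adj G v u then toℕ (indicator D u) else 0)
  term u with adj G v u | lookup D u
  ... | false | _     = refl
  ... | true  | true  = refl
  ... | true  | false = refl

nbrSum+nbrsIn-complement : (G : Graph n) (D : Subset n) {v : Fin n} → v ∉ D →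
  nbrSum G (indicator D) v + nbrsIn (complement G) D v ≡ ∣ D ∣
nbrSum+nbrsIn-complement G D {v} v∉D = begin
  nbrSum G (indicator D) v + nbrsIn (complement G) D v
    ≡⟨ cong (nbrSum G (indicator D) v +_) (nbrsIn≡nbrWeight (complement G) D v) ⟩
  nbrWeight G χ v + nbrWeight (complement G) χ v
    ≡⟨ nbrWeight+nbrWeight-complement G χ v (cong toℕ (∉⇒indicator≡0 D v∉D)) ⟩
  weight (indicator D)
    ≡⟨ ∣∣≡weight-indicator D ⟨
  ∣ D ∣ ∎
  where
  χ : Fin _ → ℕ
  χ = toℕ ∘ indicator D

nbrsIn≡1⇒adjacent : (G : Graph n) (D : Subset n) (v : Fin n) → nbrsIn G D v ≡ 1 →
  Σ (Fin n) λ u → u ∈ D × adj G v u ≡ true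
nbrsIn≡1⇒adjacent G D v eq with sumFin≡1⇒singleton _ eq
... | u , term≡1 , _ with adj G v u in v~u | lookup D u in u∈D
...   | true  | true  = u , lookup⇒[]= u D u∈D , v~u
...   | true  | false with () ← term≡1
...   | false | _     with () ← term≡1

module _ (G : Graph n) (D : Subset n) (∣D∣≡3 : ∣ D ∣ ≡ 3) where

  indicator-PIDF⇒perfectDominating-complement :
    IsPIDF G (indicator D) → PerfectDominating (complement G) D
  indicator-PIDF⇒perfectDominating-complement pidf =
    (λ v v∉D → nbrsIn≡1⇒adjacent (complement G) D v (exactlyOne v v∉D)) , exactlyOne
    where
    exactlyOne : ∀ v → v ∉ D → nbrsIn (complement G) D v ≡ 1
    exactlyOne v v∉D = +-cancelˡ-≡ 2 _ _ (begin
      2 + nbrsIn (complement G) D v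
        ≡⟨ cong (_+ nbrsIn (complement G) D v) (pidf v (∉⇒indicator≡0 D v∉D)) ⟨
      nbrSum G (indicator D) v + nbrsIn (complement G) D v
        ≡⟨ nbrSum+nbrsIn-complement G D v∉D ⟩
      ∣ D ∣
        ≡⟨ ∣D∣≡3 ⟩
      3 ∎)

  perfectDominating-complement⇒indicator-PIDF :
    PerfectDominating (complement G) D → IsPIDF G (indicator D)
  perfectDominating-complement⇒indicator-PIDF (_ , exactlyOne) v χv≡0 = +-cancelʳ-≡ 1 _ _ (begin
    nbrSum G (indicator D) v + 1
      ≡⟨ cong (nbrSum G (indicator D) v +_) (exactlyOne v v∉D) ⟨
    nbrSum G (indicator D) v + nbrsIn (complement G) D v
      ≡⟨ nbrSum+nbrsIn-complement G D v∉D ⟩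
    ∣ D ∣
      ≡⟨ ∣D∣≡3 ⟩
    3 ∎)
    where
    v∉D : v ∉ D
    v∉D = indicator≡0⇒∉ D χv≡0

if-vanish : (c : Bool) {k : ℕ} → k ≡ 0 → (if c then k else 0) ≡ 0
if-vanish true  k≡0 = k≡0
if-vanish false _   = refl

nbrWeight-point : (G : Graph n) (h : Fin n → ℕ) {a : Fin n} (v : Fin n) →
  (∀ x → x ≢ a → h x ≡ 0) → nbrWeight G h v ≡ (if adj G v a then h a else 0)
nbrWeight-point G h {a} v vanish = sumFin-point _ a (λ x x≢a → if-vanish (adj G v x) (vanish x x≢a))

nbrWeight-pair : (G : Graph n) (h : Fin n → ℕ) {a b : Fin n} (v : Fin n) → b ≢ a →
  (∀ x → x ≢ a → x ≢ b → h x ≡ 0) →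
  nbrWeight G h v ≡ (if adj G v a then h a else 0) + (if adj G v b then h b else 0)
nbrWeight-pair G h v b≢a vanish =
  sumFin-pair _ b≢a (λ x x≢a x≢b → if-vanish (adj G v x) (vanish x x≢a x≢b))

pointMass : Fin n → Fin n → Fin 3
pointMass a v = if does (v ≟ a) then 2F else 0F

pointMass-self : (a : Fin n) → pointMass a a ≡ 2F
pointMass-self a with a ≟ a
... | yes _   = refl
... | no a≢a = ⊥-elim (a≢a refl)

pointMass-other : {a x : Fin n} → x ≢ a → pointMass a x ≡ 0F
pointMass-other {a = a} {x} x≢a with x ≟ a
... | yes x≡a = ⊥-elim (x≢a x≡a)
... | no _    = refl

weight-pointMass : (a : Fin n) → weight (pointMass a) ≡ 2
weight-pointMass a =
  trans (sumFin-point _ a (λ x x≢a → cong toℕ (pointMass-other x≢a))) (cong toℕ (pointMass-self a))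

universal-vertex-PIDF : (G : Graph n) (a : Fin n) → (∀ v → v ≢ a → adj G v a ≡ true) →
  IsPIDF G (pointMass a)
universal-vertex-PIDF G a universal v pv≡0 = begin
  nbrSum G (pointMass a) v
    ≡⟨ nbrWeight-point G (toℕ ∘ pointMass a) v (λ x x≢a → cong toℕ (pointMass-other x≢a)) ⟩
  (if adj G v a then toℕ (pointMass a a) else 0)
    ≡⟨ cong (λ c → if c then toℕ (pointMass a a) else 0) (universal v v≢a) ⟩
  toℕ (pointMass a a)
    ≡⟨ cong toℕ (pointMass-self a) ⟩
  2 ∎
  where
  v≢a : v ≢ a
  v≢a refl with () ← trans (sym (pointMass-self a)) pv≡0

isolated⇒unreachable : (G : Graph n) {a b : Fin n} → (∀ x → adj G b x ≡ false) → b ≢ a →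
  ¬ Reachable G b a
isolated⇒unreachable G isolated b≢a here = b≢a refl
isolated⇒unreachable G isolated b≢a (step {v = x} b~x _) with () ← trans (sym b~x) (isolated x)

weighted-2+1≡2 : (x y : Bool) → (if x then 2 else 0) + (if y then 1 else 0) ≡ 2 →
  x ≡ true × y ≡ false
weighted-2+1≡2 true  false _ = refl , refl
weighted-2+1≡2 true  true  ()
weighted-2+1≡2 false true  ()
weighted-2+1≡2 false false ()

module _ (G : Graph n) (f : Fin n → Fin 3) (pidf : IsPIDF G f)
         {a b : Fin n} (fa≡2 : toℕ (f a) ≡ 2) (fb≡1 : toℕ (f b) ≡ 1) (b≢a : b ≢ a)
         (rest : ∀ x → x ≢ a → x ≢ b → toℕ (f x) ≡ 0) where

  others-adjacent-to-a-not-b : ∀ v → v ≢ a → v ≢ b → adj G v a ≡ true × adj G v b ≡ false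
  others-adjacent-to-a-not-b v v≢a v≢b = weighted-2+1≡2 (adj G v a) (adj G v b) (begin
    (if adj G v a then 2 else 0) + (if adj G v b then 1 else 0)
      ≡⟨ cong₂ (λ p q → (if adj G v a then p else 0) + (if adj G v b then q else 0)) fa≡2 fb≡1 ⟨
    (if adj G v a then toℕ (f a) else 0) + (if adj G v b then toℕ (f b) else 0)
      ≡⟨ nbrWeight-pair G (toℕ ∘ f) v b≢a rest ⟨
    nbrSum G f v
      ≡⟨ pidf v (toℕ-injective (rest v v≢a v≢b)) ⟩
    2 ∎)

  adjacent⇒universal : adj G b a ≡ true → ∀ v → v ≢ a → adj G v a ≡ true
  adjacent⇒universal b~a v v≢a with v ≟ b
  ... | yes refl = b~a
  ... | no v≢b   = proj₁ (others-adjacent-to-a-not-b v v≢a v≢b)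

  nonadjacent⇒isolated : adj G b a ≡ false → ∀ x → adj G b x ≡ false
  nonadjacent⇒isolated b≁a x with x ≟ a | x ≟ b
  ... | yes refl | _        = b≁a
  ... | no _     | yes refl = adj-irrefl G b
  ... | no x≢a   | no x≢b   = trans (adj-sym G b x) (proj₂ (others-adjacent-to-a-not-b x x≢a x≢b))

weight3-PIDF-avoids-2 : (G : Graph n) → Connected G → PIDNumberGreaterThan2 G →
  (f : Fin n → Fin 3) → IsPIDF G f → weight f ≡ 3 → ∀ a → f a ≢ 2F
weight3-PIDF-avoids-2 G connected γ>2 f pidf weight≡3 a fa≡2F with cong toℕ fa≡2F
... | fa≡2 with sumFin≡+1⇒pair (toℕ ∘ f) a (trans weight≡3 (cong (_+ 1) (sym fa≡2)))
... | b , b≢a , fb≡1 , rest with adj G b a in b~a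
...   | true  = n≮n 2 (subst (2 <_) (weight-pointMass a)
                  (γ>2 _ (universal-vertex-PIDF G a (adjacent⇒universal G f pidf fa≡2 fb≡1 b≢a rest b~a))))
...   | false = isolated⇒unreachable G (nonadjacent⇒isolated G f pidf fa≡2 fb≡1 b≢a rest b~a) b≢a
                  (connected b a)

support : (Fin n → Fin 3) → Subset n
support f = tabulate (λ u → not (does (f u ≟ 0F)))

avoids-2⇒≗indicator-support : (f : Fin n → Fin 3) → (∀ a → f a ≢ 2F) → f ≗ indicator (support f)
avoids-2⇒≗indicator-support f avoids-2 u
  rewrite lookup∘tabulate (λ u → not (does (f u ≟ 0F))) u with f u in fu
... | 0F = refl
... | 1F = refl
... | 2F = ⊥-elim (avoids-2 u fu)

weight-cong : {f g : Fin n → Fin 3} → f ≗ g → weight f ≡ weight g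
weight-cong f≗g = sumFin-cong (cong toℕ ∘ f≗g)

IsPIDF-resp-≗ : (G : Graph n) {f g : Fin n → Fin 3} → f ≗ g → IsPIDF G f → IsPIDF G g
IsPIDF-resp-≗ G f≗g pidf v gv≡0 =
  trans (sym (nbrWeight-cong G (cong toℕ ∘ f≗g) v)) (pidf v (trans (f≗g v) gv≡0))

theorem16 : ∀ {n} (G : Graph n) → Connected G → PIDNumberGreaterThan2 G →
    (PIDNumber G 3 ⇔ Σ (Subset n) λ D → ∣ D ∣ ≡ 3 × PerfectDominating (complement G) D)
theorem16 G connected γ>2 = mk⇔ forward backward
  where
  forward : PIDNumber G 3 → Σ (Subset _) λ D → ∣ D ∣ ≡ 3 × PerfectDominating (complement G) D
  forward ((f , pidf , weight≡3) , _) =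
    D , ∣D∣≡3 , indicator-PIDF⇒perfectDominating-complement G D ∣D∣≡3 (IsPIDF-resp-≗ G f≗χ pidf)
    where
    D : Subset _
    D = support f
    f≗χ : f ≗ indicator D
    f≗χ = avoids-2⇒≗indicator-support f (weight3-PIDF-avoids-2 G connected γ>2 f pidf weight≡3)
    ∣D∣≡3 : ∣ D ∣ ≡ 3
    ∣D∣≡3 = trans (∣∣≡weight-indicator D) (trans (sym (weight-cong f≗χ)) weight≡3)

  backward : Σ (Subset _) (λ D → ∣ D ∣ ≡ 3 × PerfectDominating (complement G) D) → PIDNumber G 3
  backward (D , ∣D∣≡3 , perfect) =
    (indicator D , perfectDominating-complement⇒indicator-PIDF G D ∣D∣≡3 perfect
                 , trans (sym (∣∣≡weight-indicator D)) ∣D∣≡3)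
    , γ>2
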